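{- Let $\mathfrak{M}$ be a structure in the class $\mathcal{N}$ and let $\mathcal{M}$ be a neighbourhood model with $\mathfrak{M}\cong\mathcal{M}^\circ$. If $\mathfrak{M}$ is $\omega$-saturated, then $\mathcal{M}$ is modally saturated.
   Context: Modal formulas: $\varphi::=\bot\mid p_i\mid\neg\varphi\mid\varphi\wedge\varphi\mid\Box\varphi$ ($i\in\omega$). A neighbourhood model $\langle S,\nu,V\rangle$ has $\nu\colon S\to\mathcal{P}(\mathcal{P}(S))$; $s\models\Box\varphi$ iff the truth set of $\varphi$ is in $\nu(s)$. $\mathcal{L}_{FO}$ is the two-sorted first-order language with sorts $\mathsf{s}$ (states) and $\mathsf{n}$ (neighbourhoods), unary predicates $P_i$ on sort $\mathsf{s}$, a relation $N$ from sort $\mathsf{s}$ to sort $\mathsf{n}$ and a relation $E$ from sort $\mathsf{n}$ to sort $\mathsf{s}$. The first-order translation $\mathcal{M}^\circ$ of $\langle S,\nu,V\rangle$ has state domain $S$, neighbourhood domain $\bigcup_s\nu(s)$, $P_i=V(p_i)$, $N=\{(s,U)\mid U\in\nu(s)\}$, $E=\{(U,s)\mid s\in U\}$; $\mathcal{N}$ is the class of $\mathcal{L}_{FO}$-structures isomorphic to some $\mathcal{M}^\circ$. A structure is $\omega$-saturated if for every finite set $C$ of its elements, every set of formulas in one free variable in the language expanded with constants for $C$ that is finitely satisfiable in it is satisfiable in it. Modal equivalence and modal coherence: states are modally equivalent if they satisfy the same modal formulas; a set is modally coherent if it is a union of modal-equivalence classes. $X\subseteq S$ is modally compact if every set of modal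 formulas each finite subset of which is satisfied at some point of $X$ is itself satisfied at some point of $X$; $\mathcal{M}$ is modally saturated if for each $s$ and each modally coherent $X\in\nu(s)$, both $X$ and $S\setminus X$ are modally compact. -}

module Defs where

open import Level using (Level; Lift; lift; lower) renaming (suc to lsuc; zero to lzero)
open import Data.Nat using (ℕ)
open import Data.Fin using (Fin)
open import Data.List using (List; []; _∷_)
open import Data.List.Relation.Unary.All using (All)
open import Data.Product using (Σ; _×_; _,_; proj₁; proj₂)
open import Data.Empty using (⊥)
open import Data.Unit using (⊤)
open import Data.Sum using (_⊎_)
open import Relation.Nullary using (¬_)
open import Relation.Binary using (Setoid; IsEquivalence)
open import Relation.Binary.PropositionalEquality as P using (_≡_; refl; subst)

_⇔_ : ∀ {a b} → Set a → Set b → Set (a Level.⊔ b)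
A ⇔ B = (A → B) × (B → A)

data MForm : Set where
  mfalse : MForm
  mvar   : ℕ → MForm
  mnot   : MForm → MForm
  mand   : MForm → MForm → MForm
  mbox   : MForm → MForm

-- A neighbourhood model.  Subsets of S are predicates S → Set, identified
-- up to extensional equivalence; ν s is a set of subsets, hence required to
-- be closed under extensional equivalence.
record NbhdModel : Set₁ where
  field
    S     : Set
    ν     : S → (S → Set) → Set
    ν-ext : ∀ {s} {U U' : S → Set} → (∀ x → U x ⇔ U' x) → ν s U → ν s U'
    V     : ℕ → S → Set

module _ (M : NbhdModel) where
  open NbhdModel M

  _⊨_ : S → MForm → Set
  s ⊨ mfalse     = ⊥
  s ⊨ mvar i     = V i s
  s ⊨ mnot φ     = ¬ (s ⊨ φ)
  s ⊨ mand φ ψ   = (s ⊨ φ) × (s ⊨ ψ)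
  s ⊨ mbox φ     = ν s (λ t → t ⊨ φ)

  ModallyEquivalent : S → S → Set
  ModallyEquivalent s t = ∀ φ → (s ⊨ φ) ⇔ (t ⊨ φ)

  ModallyCoherent : (S → Set) → Set
  ModallyCoherent X = ∀ s t → ModallyEquivalent s t → X s → X t

  ModallyCompact : (S → Set) → Set₁
  ModallyCompact X =
    (Φ : MForm → Set) →
    ((Δ : List MForm) → All Φ Δ → Σ S λ x → X x × All (λ φ → x ⊨ φ) Δ) →
    Σ S λ x → X x × (∀ φ → Φ φ → x ⊨ φ)

  ModallySaturated : Set₁
  ModallySaturated =
    ∀ s (X : S → Set) → ModallyCoherent X → ν s X →
    ModallyCompact X × ModallyCompact (λ x → ¬ X x)

data Sort : Set where
  st nb : Sort

-- structures: each sort has a setoid domain (the setoid equality interprets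
-- the equality symbol), relations respect equality
record Structure : Set₂ where
  field
    dom   : Sort → Setoid (lsuc lzero) lzero
  Car : Sort → Set₁
  Car σ = Setoid.Carrier (dom σ)
  _≈_ : ∀ {σ} → Car σ → Car σ → Set
  _≈_ {σ} = Setoid._≈_ (dom σ)
  field
    Pr    : ℕ → Car st → Set
    Nr    : Car st → Car nb → Set
    Er    : Car nb → Car st → Set
    Pr-resp : ∀ {i a a'} → a ≈ a' → Pr i a → Pr i a'
    Nr-resp : ∀ {a a' u u'} → a ≈ a' → u ≈ u' → Nr a u → Nr a' u'
    Er-resp : ∀ {u u' a a'} → u ≈ u' → a ≈ a' → Er u a → Er u' a'

record _≅_ (𝔄 𝔅 : Structure) : Set₁ where
  module A = Structure 𝔄
  module B = Structure 𝔅
  field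
    f      : ∀ σ → A.Car σ → B.Car σ
    f-cong : ∀ σ {x y} → x A.≈ y → f σ x B.≈ f σ y
    f-inj  : ∀ σ {x y} → f σ x B.≈ f σ y → x A.≈ y
    f-surj : ∀ σ (y : B.Car σ) → Σ (A.Car σ) λ x → f σ x B.≈ y
    f-P    : ∀ i a → A.Pr i a ⇔ B.Pr i (f st a)
    f-N    : ∀ a u → A.Nr a u ⇔ B.Nr (f st a) (f nb u)
    f-E    : ∀ u a → A.Er u a ⇔ B.Er (f nb u) (f st a)

-- variables (de Bruijn) and constants: formulas over k constants of sort st
-- and m constants of sort nb
data Var : List Sort → Sort → Set where
  here  : ∀ {Γ σ} → Var (σ ∷ Γ) σ
  there : ∀ {Γ σ τ} → Var Γ σ → Var (τ ∷ Γ) σ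

Const : ℕ → ℕ → Sort → Set
Const k m st = Fin k
Const k m nb = Fin m

data Term (k m : ℕ) (Γ : List Sort) (σ : Sort) : Set where
  var : Var Γ σ → Term k m Γ σ
  con : Const k m σ → Term k m Γ σ

data Formula (k m : ℕ) (Γ : List Sort) : Set where
  ftrue fls : Formula k m Γ
  fP    : ℕ → Term k m Γ st → Formula k m Γ
  fN    : Term k m Γ st → Term k m Γ nb → Formula k m Γ
  fE    : Term k m Γ nb → Term k m Γ st → Formula k m Γ
  feq   : ∀ {σ} → Term k m Γ σ → Term k m Γ σ → Formula k m Γ
  fnot  : Formula k m Γ → Formula k m Γ
  fand for fimp : Formula k m Γ → Formula k m Γ → Formula k m Γ
  fall fex : (σ : Sort) → Formula k m (σ ∷ Γ) → Formula k m Γ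

module Semantics (𝔐 : Structure) where
  open Structure 𝔐

  Env : List Sort → Set₁
  Env Γ = ∀ {σ} → Var Γ σ → Car σ

  _▸_ : ∀ {Γ σ} → Env Γ → Car σ → Env (σ ∷ Γ)
  (ρ ▸ a) here      = a
  (ρ ▸ a) (there x) = ρ x

  ∅ : Env []
  ∅ ()

  Consts : ℕ → ℕ → Set₁
  Consts k m = ∀ σ → Const k m σ → Car σ

  module _ {k m : ℕ} (c : Consts k m) where
    ⟦_⟧t : ∀ {Γ σ} → Term k m Γ σ → Env Γ → Car σ
    ⟦ var x ⟧t ρ = ρ x
    ⟦_⟧t {σ = σ} (con i) ρ = c σ i

    Sat : ∀ {Γ} → Env Γ → Formula k m Γ → Set₁
    Sat ρ ftrue       = Lift _ ⊤
    Sat ρ fls         = Lift _ ⊥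
    Sat ρ (fP i t)    = Lift _ (Pr i (⟦ t ⟧t ρ))
    Sat ρ (fN t u)    = Lift _ (Nr (⟦ t ⟧t ρ) (⟦ u ⟧t ρ))
    Sat ρ (fE u t)    = Lift _ (Er (⟦ u ⟧t ρ) (⟦ t ⟧t ρ))
    Sat ρ (feq t u)   = Lift _ (⟦ t ⟧t ρ ≈ ⟦ u ⟧t ρ)
    Sat ρ (fnot φ)    = ¬ Sat ρ φ
    Sat ρ (fand φ ψ)  = Sat ρ φ × Sat ρ ψ
    Sat ρ (for φ ψ)   = Sat ρ φ ⊎ Sat ρ ψ
    Sat ρ (fimp φ ψ)  = Sat ρ φ → Sat ρ ψ
    Sat ρ (fall σ φ)  = (a : Car σ) → Sat (ρ ▸ a) φ
    Sat ρ (fex σ φ)   = Σ (Car σ) λ a → Sat (ρ ▸ a) φ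

  -- ω-saturation: for every finite set of parameters (k elements of sort st,
  -- m of sort nb), every set Φ of formulas in one free variable (of either
  -- sort σ) that is finitely satisfiable is satisfiable
  OmegaSaturated : Set₁
  OmegaSaturated =
    ∀ (k m : ℕ) (c : Consts k m) (σ : Sort) (Φ : Formula k m (σ ∷ []) → Set) →
    ((Δ : List (Formula k m (σ ∷ []))) → All Φ Δ →
       Σ (Car σ) λ a → All (λ φ → Sat c (∅ ▸ a) φ) Δ) →
    Σ (Car σ) λ a → ∀ φ → Φ φ → Sat c (∅ ▸ a) φ

module Translation (M : NbhdModel) where
  open NbhdModel M

  stSetoid : Setoid (lsuc lzero) lzero
  stSetoid = record
    { Carrier = Lift (lsuc lzero) S
    ; _≈_ = λ x y → lower x ≡ lower y
    ; isEquivalence = record { refl = refl ; sym = P.sym ; trans = P.trans } }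

  -- neighbourhood domain: ⋃_s ν(s), subsets identified extensionally
  NbhdDom : Set₁
  NbhdDom = Σ (S → Set) λ U → Σ S λ s → ν s U

  nbSetoid : Setoid (lsuc lzero) lzero
  nbSetoid = record
    { Carrier = NbhdDom
    ; _≈_ = λ U U' → ∀ x → proj₁ U x ⇔ proj₁ U' x
    ; isEquivalence = record
      { refl  = λ x → (λ p → p) , (λ p → p)
      ; sym   = λ e x → proj₂ (e x) , proj₁ (e x)
      ; trans = λ e e' x → (λ p → proj₁ (e' x) (proj₁ (e x) p))
                         , (λ p → proj₂ (e x) (proj₂ (e' x) p)) } }

  domM : Sort → Setoid (lsuc lzero) lzero
  domM st = stSetoid
  domM nb = nbSetoid

  translation : Structure
  translation = record
    { dom = domM
    ; Pr  = λ i a → V i (lower a)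
    ; Nr  = λ a U → ν (lower a) (proj₁ U)
    ; Er  = λ U a → proj₁ U (lower a)
    ; Pr-resp = λ { {i} e p → subst (V i) e p }
    ; Nr-resp = λ { {a} e e' p → subst (λ s → ν s _) e (ν-ext e' p) }
    ; Er-resp = λ { {u} {u'} e e' p → subst (proj₁ u') e' (proj₁ (e _) p) }
    }

_° : NbhdModel → Structure
M ° = Translation.translation M

-- Fix an isomorphism 𝔐 ≅ M°, so every element of sort st names a state and
-- every element of sort nb names a neighbourhood (its extent).
--  * The standard translation ST turns a modal formula into a first-order
--    formula in one state variable; □φ becomes "some neighbourhood of x has
--    exactly the truth set of φ as extent".  Along the isomorphism, ST φ holds
--    of a exactly when φ holds at the state named by a.
--  * Call Y ⊆ S definable if some first-order formula χ with parameters holds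
--    of a exactly when the state named by a lies in Y.  By ω-saturation every
--    definable set is modally compact: a set of modal formulas finitely
--    satisfiable in Y yields, via ST, a finitely satisfiable first-order type
--    containing χ.
--  * Definable sets are closed under complement, and every neighbourhood X
--    is definable by E(u, x) with the single parameter u naming X.
-- Hence X and S ∖ X are modally compact for each X ∈ ν(s).
module Submission where

open import Defs
open import Level using (Lift; lift; lower)
open import Data.Nat using (ℕ)
open import Data.Fin using (zero)
open import Data.List using (List; []; _∷_)
open import Data.List.Relation.Unary.All using (All; []; _∷_)
open import Data.Product using (Σ; _×_; _,_; proj₁; proj₂)
open import Data.Sum using (_⊎_; inj₁; inj₂)
open import Relation.Nullary using (¬_)
open import Relation.Binary.PropositionalEquality using (_≡_; refl)

⇔-sym : ∀ {a b} {A : Set a} {B : Set b} → A ⇔ B → B ⇔ A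
⇔-sym (f , g) = g , f

⇔-trans : ∀ {a b c} {A : Set a} {B : Set b} {C : Set c} → A ⇔ B → B ⇔ C → A ⇔ C
⇔-trans (f , g) (f' , g') = (λ x → f' (f x)) , (λ z → g (g' z))

¬-cong : ∀ {a b} {A : Set a} {B : Set b} → A ⇔ B → (¬ A) ⇔ (¬ B)
¬-cong (f , g) = (λ na b → na (g b)) , (λ nb a → nb (f a))

lift⇔ : ∀ {a ℓ} {A : Set a} → Lift ℓ A ⇔ A
lift⇔ = lower , lift

ST : ∀ {k m Γ} → Var Γ st → MForm → Formula k m Γ
ST v mfalse     = fls
ST v (mvar i)   = fP i (var v)
ST v (mnot φ)   = fnot (ST v φ)
ST v (mand φ ψ) = fand (ST v φ) (ST v ψ)
ST v (mbox φ)   = fex nb (fand (fN (var (there v)) (var here))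
  (fall st (fand (fimp member (ST here φ)) (fimp (ST here φ) member))))
  where
  member : Formula _ _ (st ∷ nb ∷ _)
  member = fE (var (there here)) (var here)

module Saturation (𝔐 : Structure) (M : NbhdModel) (iso : 𝔐 ≅ (M °)) where
  open NbhdModel M
  module I = _≅_ iso
  module A = Structure 𝔐
  open Semantics 𝔐

  _⊩_ : S → MForm → Set
  _⊩_ = _⊨_ M

  ∥_∥ : MForm → S → Set
  ∥ φ ∥ t = t ⊩ φ

  state : A.Car st → S
  state a = lower (I.f st a)

  extent : A.Car nb → S → Set
  extent u = proj₁ (I.f nb u)

  state-surj : ∀ t → Σ (A.Car st) λ a → state a ≡ t
  state-surj t = I.f-surj st (lift t)

  along-state : {P Q : S → Set} → (∀ a → P (state a) ⇔ Q (state a)) → ∀ t → P t ⇔ Q t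
  along-state h t with state-surj t
  ... | a , refl = h a

  E⇔extent : ∀ u a → A.Er u a ⇔ extent u (state a)
  E⇔extent u a = I.f-E u a

  module _ {k m : ℕ} (c : Consts k m) where
    ST-correct : ∀ {Γ} (ρ : Env Γ) (v : Var Γ st) φ → Sat c ρ (ST v φ) ⇔ (state (ρ v) ⊩ φ)
    ST-correct ρ v mfalse     = (λ ()) , (λ ())
    ST-correct ρ v (mvar i)   = ⇔-trans lift⇔ (I.f-P i (ρ v))
    ST-correct ρ v (mnot φ)   = ¬-cong (ST-correct ρ v φ)
    ST-correct ρ v (mand φ ψ) =
      (λ { (p , q) → proj₁ (ST-correct ρ v φ) p , proj₁ (ST-correct ρ v ψ) q })
      , (λ { (p , q) → proj₂ (ST-correct ρ v φ) p , proj₂ (ST-correct ρ v ψ) q })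
    ST-correct ρ v (mbox φ)   = box⇒ , box⇐
      where
      Body : A.Car nb → Set₁
      Body u = ∀ a → Sat c ((ρ ▸ u) ▸ a) (fE (var (there here)) (var here))
                   ⇔ Sat c ((ρ ▸ u) ▸ a) (ST here φ)

      body⇔extent : ∀ u → Body u ⇔ (∀ t → extent u t ⇔ ∥ φ ∥ t)
      body⇔extent u =
          (λ h → along-state λ a →
             ⇔-trans (⇔-sym (⇔-trans lift⇔ (E⇔extent u a)))
                     (⇔-trans (h a) (ST-correct ((ρ ▸ u) ▸ a) here φ)))
        , (λ e a →
             ⇔-trans (⇔-trans lift⇔ (E⇔extent u a))
                     (⇔-trans (e (state a)) (⇔-sym (ST-correct ((ρ ▸ u) ▸ a) here φ))))

      box⇒ : Sat c ρ (ST v (mbox φ)) → state (ρ v) ⊩ mbox φ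
      box⇒ (u , lift n , h) = ν-ext (proj₁ (body⇔extent u) h) (proj₁ (I.f-N (ρ v) u) n)

      box⇐ : state (ρ v) ⊩ mbox φ → Sat c ρ (ST v (mbox φ))
      box⇐ p with I.f-surj nb (∥ φ ∥ , state (ρ v) , p)
      ... | u , e = u
                  , lift (proj₂ (I.f-N (ρ v) u) (ν-ext (λ t → ⇔-sym (e t)) p))
                  , proj₂ (body⇔extent u) e

  record Defines {k m} (c : Consts k m) (χ : Formula k m (st ∷ [])) (Y : S → Set) : Set₁ where
    constructor defined-by
    field defines : ∀ a → Sat c (∅ ▸ a) χ ⇔ Y (state a)
  open Defines

  complement-defines : ∀ {k m} {c : Consts k m} {χ Y} →
                       Defines c χ Y → Defines c (fnot χ) (λ x → ¬ Y x)
  complement-defines d = defined-by λ a → ¬-cong (defines d a)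

  parameter : A.Car nb → Consts 0 1
  parameter u st ()
  parameter u nb _ = u

  inParameter : Formula 0 1 (st ∷ [])
  inParameter = fE (con zero) (var here)

  extent-defines : (u : A.Car nb) → Defines (parameter u) inParameter (extent u)
  extent-defines u = defined-by λ a → ⇔-trans lift⇔ (E⇔extent u a)

  module _ (saturated : OmegaSaturated) {k m : ℕ} {c : Consts k m}
           {χ : Formula k m (st ∷ [])} {Y : S → Set} (definition : Defines c χ Y) where

    TypeIn : (MForm → Set) → Formula k m (st ∷ []) → Set
    TypeIn Φ ψ = (ψ ≡ χ) ⊎ Σ MForm λ φ → Φ φ × (ψ ≡ ST here φ)

    modalPart : ∀ {Φ Δ} → All (TypeIn Φ) Δ → List MForm
    modalPart []                  = []
    modalPart (inj₁ _ ∷ ps)       = modalPart ps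
    modalPart (inj₂ (φ , _) ∷ ps) = φ ∷ modalPart ps

    modalPart-⊆ : ∀ {Φ Δ} (ps : All (TypeIn Φ) Δ) → All Φ (modalPart ps)
    modalPart-⊆ []                      = []
    modalPart-⊆ (inj₁ _ ∷ ps)           = modalPart-⊆ ps
    modalPart-⊆ (inj₂ (φ , q , _) ∷ ps) = q ∷ modalPart-⊆ ps

    realises : ∀ {Φ Δ} (ps : All (TypeIn Φ) Δ) a → Y (state a) →
               All (state a ⊩_) (modalPart ps) → All (Sat c (∅ ▸ a)) Δ
    realises []                         a y hs       = []
    realises (inj₁ refl ∷ ps)           a y hs       = proj₂ (defines definition a) y ∷ realises ps a y hs
    realises (inj₂ (φ , _ , refl) ∷ ps) a y (h ∷ hs) =
      proj₂ (ST-correct c (∅ ▸ a) here φ) h ∷ realises ps a y hs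

    definable-compact : ModallyCompact M Y
    definable-compact Φ finSat with saturated k m c st (TypeIn Φ) finSatType
      where
      finSatType : ∀ Δ → All (TypeIn Φ) Δ → Σ (A.Car st) λ a → All (Sat c (∅ ▸ a)) Δ
      finSatType Δ ps with finSat (modalPart ps) (modalPart-⊆ ps)
      ... | x , yx , hs with state-surj x
      ... | a , refl = a , realises ps a yx hs
    ... | a , h = state a
                , proj₁ (defines definition a) (h χ (inj₁ refl))
                , λ φ q → proj₁ (ST-correct c (∅ ▸ a) here φ) (h (ST here φ) (inj₂ (φ , q , refl)))

  modally-saturated : OmegaSaturated → ModallySaturated M
  modally-saturated saturated s X _ X∈νs with I.f-surj nb (X , s , X∈νs)
  ... | u , sameExtent =
      definable-compact saturated definesX
    , definable-compact saturated (complement-defines definesX)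
    where
    definesX : Defines (parameter u) inParameter X
    definesX = defined-by λ a →
      ⇔-trans (defines (extent-defines u) a) (sameExtent (state a))

lemma5p6 : (𝔐 : Structure) (M : NbhdModel) → 𝔐 ≅ (M °) →
    Semantics.OmegaSaturated 𝔐 → ModallySaturated M
lemma5p6 𝔐 M iso = Saturation.modally-saturated 𝔐 M iso
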